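{- For $i=1,\ldots,k$ let $W_i\le S_{d_i}$, where the symmetric groups act on pairwise disjoint sets $\Omega_1,\ldots,\Omega_k$, and let $W=W_1\times\cdots\times W_k$ acting on $\Omega=\bigcup_i\Omega_i$. If, for each $i$, $\mathcal{X}_i$ is a subgroup partition for $W_i$ of index $m_i$, then $\bigcup_i\mathcal{X}_i$ is a subgroup partition for $W$ of index $\prod_i m_i$. Moreover, every subgroup partition for $W$ is of this form.
   Context: For a permutation group $W$ on a finite set $\Omega$ and a partition $\mathcal{X}$ of $\Omega$, define $\operatorname{Stab}_W(\mathcal{X})=\{w\in W : w(X)= X \text{ for all } X\in\mathcal{X}\}$ (equivalently $w(x)\in X$ whenever $x\in X\in\mathcal{X}$). The partition $\mathcal{X}$ is a subgroup partition for $W$ if there exists $U\le W$ whose set of orbits on $\Omega$ is exactly $\mathcal{X}$. The index (orbit index) of a subgroup partition $\mathcal{X}$ is $(W:\mathcal{X}):=(W:\operatorname{Stab}_W(\mathcal{X}))$. -}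

module Defs where

open import Level using (0ℓ)
open import Data.Nat using (ℕ; zero; suc; _*_)
open import Data.Fin using (Fin; zero; suc)
open import Data.Product using (Σ; Σ-syntax; ∃; ∃-syntax; _×_; _,_)
open import Data.List using (List; length)
open import Data.List.Relation.Unary.Any using (Any)
open import Data.List.Relation.Unary.AllPairs using (AllPairs)
open import Relation.Nullary using (¬_)
open import Relation.Binary using (IsEquivalence)
open import Relation.Binary.PropositionalEquality using (_≡_)
open import Function using (_∘_; id)
open import Function.Bundles using (_⇔_)

Map : Set → Set
Map A = A → A

_≈_ : {A : Set} → Map A → Map A → Set
f ≈ g = ∀ x → f x ≡ g x

record IsPermGroup {A : Set} (W : Map A → Set) : Set where
  field
    resp : ∀ {f g} → f ≈ g → W f → W g
    hasId : W id
    comp : ∀ {f g} → W f → W g → W (f ∘ g)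
    inv : ∀ {f} → W f → Σ[ g ∈ Map A ] (W g × (g ∘ f) ≈ id × (f ∘ g) ≈ id)

record IsSubgroup {A : Set} (U W : Map A → Set) : Set where
  field
    isGroup : IsPermGroup U
    sub : ∀ {f} → U f → W f

-- A partition of A, given by its "same block" equivalence relation.
record Partition (A : Set) : Set₁ where
  field
    _~_ : A → A → Set
    isEquiv : IsEquivalence _~_
open Partition public

SamePartition : {A : Set} → Partition A → Partition A → Set
SamePartition X Y = ∀ x y → (_~_ X x y ⇔ _~_ Y x y)

OrbitsAre : {A : Set} → (Map A → Set) → Partition A → Set
OrbitsAre U X = ∀ x y → (_~_ X x y ⇔ (∃[ u ] (U u × u x ≡ y)))

IsSubgroupPartition : {A : Set} → (Map A → Set) → Partition A → Set₁
IsSubgroupPartition {A} W X = Σ[ U ∈ (Map A → Set) ] (IsSubgroup U W × OrbitsAre U X)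

Stab : {A : Set} → (Map A → Set) → Partition A → Map A → Set
Stab W X w = W w × (∀ x → _~_ X (w x) x)

HasSize : {A : Set} → (Map A → Set) → ℕ → Set
HasSize {A} P n = Σ[ L ∈ List (Map A) ]
  (length L ≡ n × AllPairs (λ f g → ¬ (f ≈ g)) L × (∀ f → (P f ⇔ Any (f ≈_) L)))

-- (W : X) = (W : Stab_W(X)) = m, i.e. |W| = m * |Stab_W(X)|
HasIndex : {A : Set} → (Map A → Set) → Partition A → ℕ → Set
HasIndex W X m = Σ[ a ∈ ℕ ] Σ[ b ∈ ℕ ] (HasSize W a × HasSize (Stab W X) b × a ≡ m * b)

∏ : (k : ℕ) → (Fin k → ℕ) → ℕ
∏ zero m = 1
∏ (suc k) m = m zero * ∏ k (m ∘ suc)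

-- disjoint union Ω = ⋃ Ω_i, with Ω_i = Fin (d i)
Ω : (k : ℕ) → (Fin k → ℕ) → Set
Ω k d = Σ[ i ∈ Fin k ] Fin (d i)

ProdGroup : (k : ℕ) (d : Fin k → ℕ) → ((i : Fin k) → Map (Fin (d i)) → Set) → Map (Ω k d) → Set
ProdGroup k d W w = ∀ i → Σ[ wi ∈ Map (Fin (d i)) ] (W i wi × (∀ x → w (i , x) ≡ (i , wi x)))

data UnionRel (k : ℕ) (d : Fin k → ℕ) (X : (i : Fin k) → Partition (Fin (d i))) : Ω k d → Ω k d → Set where
  ur : ∀ {i x y} → _~_ (X i) x y → UnionRel k d X (i , x) (i , y)

UnionPart : (k : ℕ) (d : Fin k → ℕ) → ((i : Fin k) → Partition (Fin (d i))) → Partition (Ω k d)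
UnionPart k d X = record { _~_ = UnionRel k d X ; isEquiv = record { refl = r ; sym = s ; trans = t } }
  where
  r : ∀ {p} → UnionRel k d X p p
  r {i , x} = ur (IsEquivalence.refl (isEquiv (X i)))
  s : ∀ {p q} → UnionRel k d X p q → UnionRel k d X q p
  s (ur {i} e) = ur (IsEquivalence.sym (isEquiv (X i)) e)
  t : ∀ {p q o} → UnionRel k d X p q → UnionRel k d X q o → UnionRel k d X p o
  t (ur {i} e) (ur f) = ur (IsEquivalence.trans (isEquiv (X i)) e f)

{-# OPTIONS --safe #-}
module Submission where

-- Subgroups Uᵢ ≤ Wᵢ with orbits Xᵢ give the subgroup ∏ Uᵢ ≤ W acting blockwise, whose orbits
-- are the union of the Xᵢ: a move of Uᵢ inside Ωᵢ extends by the identity on the other blocks.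
-- The stabiliser of ⋃ Xᵢ in W is ∏ Stab(Xᵢ), and the elements of a direct product are listed
-- without repetition by the tuples of elements of the factors, so |W| and |Stab| are both
-- products and the indices multiply. Conversely, every element of W maps each Ωᵢ onto itself,
-- so the orbits of U ≤ W lie inside the blocks, and inside Ωᵢ they are the orbits of the
-- projection πᵢ(U) ≤ Wᵢ formed by the restrictions to Ωᵢ of the elements of U.

open import Defs
open import Level using (Level; 0ℓ)
open import Data.Nat using (ℕ; zero; suc; _*_; _+_)
open import Data.Nat.Properties using (*-commutativeSemigroup)
open import Algebra.Properties.CommutativeSemigroup *-commutativeSemigroup using (interchange)
open import Data.Fin using (Fin; zero; suc; _≟_)
open import Data.Fin.Properties using (∀-cons)
open import Data.Product using (Σ-syntax; _×_; _,_; proj₁; proj₂; ∃-syntax)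
open import Data.List using (List; []; _∷_; length; map; _++_; cartesianProductWith)
open import Data.List.Properties using (length-++; length-map)
import Data.List.Relation.Unary.Any as Any
import Data.List.Relation.Unary.Any.Properties as Any
open import Data.List.Membership.Setoid using (_∈_)
open import Data.List.Membership.Setoid.Properties using (∈-map⁺; ∈-map⁻; ∈-resp-≈)
open import Data.List.Relation.Unary.All using ([])
open import Data.List.Relation.Unary.AllPairs using ([]; _∷_)
open import Data.List.Relation.Unary.Unique.Setoid using (Unique)
import Data.List.Relation.Unary.Unique.Setoid.Properties as Unique
open import Relation.Nullary using (yes; no)
open import Relation.Nullary.Negation using (contradiction)
open import Relation.Binary using (Setoid; IsEquivalence)
open import Relation.Binary.PropositionalEquality
  using (_≡_; refl; sym; trans; cong; cong₂; subst; _→-setoid_; module ≡-Reasoning)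
open import Function using (_∘_; id)
open import Function.Bundles using (_⇔_; mk⇔; Equivalence)
import Function.Properties.Equivalence as ⇔

open Equivalence using (to; from)

private
  variable
    a ℓ : Level

Π-setoid : ∀ {k} → (Fin k → Setoid a ℓ) → Setoid a ℓ
Π-setoid S = record
  { Carrier = ∀ i → Setoid.Carrier (S i)
  ; _≈_ = λ c c′ → ∀ i → Setoid._≈_ (S i) (c i) (c′ i)
  ; isEquivalence = record
    { refl = λ i → Setoid.refl (S i)
    ; sym = λ e i → Setoid.sym (S i) (e i)
    ; trans = λ e e′ i → Setoid.trans (S i) (e i) (e′ i)
    }
  }

tuples : ∀ {k} {B : Fin k → Set a} → (∀ i → List (B i)) → List (∀ i → B i)
tuples {k = zero} L = (λ ()) ∷ []
tuples {k = suc k} {B} L = cartesianProductWith (∀-cons {P = B}) (L zero) (tuples (L ∘ suc))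

length-cartesianProductWith : ∀ {A B C : Set a} (f : A → B → C) xs ys →
  length (cartesianProductWith f xs ys) ≡ length xs * length ys
length-cartesianProductWith f [] ys = refl
length-cartesianProductWith f (x ∷ xs) ys = begin
  length (map (f x) ys ++ cartesianProductWith f xs ys)
    ≡⟨ length-++ (map (f x) ys) ⟩
  length (map (f x) ys) + length (cartesianProductWith f xs ys)
    ≡⟨ cong₂ _+_ (length-map (f x) ys) (length-cartesianProductWith f xs ys) ⟩
  length ys + length xs * length ys ∎
  where open ≡-Reasoning

length-tuples : ∀ {k} {B : Fin k → Set a} (L : ∀ i → List (B i)) →
  length (tuples L) ≡ ∏ k (length ∘ L)
length-tuples {k = zero} L = refl
length-tuples {k = suc k} {B} L =
  trans (length-cartesianProductWith (∀-cons {P = B}) (L zero) (tuples (L ∘ suc)))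
        (cong (length (L zero) *_) (length-tuples (L ∘ suc)))

∈-tuples : ∀ {k} (S : Fin k → Setoid a ℓ) {L : ∀ i → List (Setoid.Carrier (S i))} {c} →
  _∈_ (Π-setoid S) c (tuples L) ⇔ (∀ i → _∈_ (S i) (c i) (L i))
∈-tuples {k = zero} S = mk⇔ (λ _ ()) (λ _ → Any.here (λ ()))
∈-tuples {k = suc k} S {L} {c} = mk⇔ split join
  where
  split : _∈_ (Π-setoid S) c (tuples L) → ∀ i → _∈_ (S i) (c i) (L i)
  split c∈ with Any.cartesianProductWith⁻ ∀-cons (λ e → e zero , e ∘ suc) (L zero) (tuples (L ∘ suc)) c∈
  ... | c₀∈ , c₊∈ = ∀-cons c₀∈ (to (∈-tuples (S ∘ suc)) c₊∈)
  join : (∀ i → _∈_ (S i) (c i) (L i)) → _∈_ (Π-setoid S) c (tuples L)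
  join c∈ = Any.cartesianProductWith⁺ ∀-cons ∀-cons (c∈ zero) (from (∈-tuples (S ∘ suc)) (c∈ ∘ suc))

tuples-unique : ∀ {k} (S : Fin k → Setoid a ℓ) {L : ∀ i → List (Setoid.Carrier (S i))} →
  (∀ i → Unique (S i) (L i)) → Unique (Π-setoid S) (tuples L)
tuples-unique {k = zero} S _ = [] ∷ []
tuples-unique {k = suc k} S L! = Unique.cartesianProductWith⁺ (S zero) (Π-setoid (S ∘ suc)) (Π-setoid S)
  ∀-cons (λ e → e zero , e ∘ suc) (L! zero) (tuples-unique (S ∘ suc) (L! ∘ suc))

_[_]≔_ : ∀ {k} {B : Fin k → Set a} → (∀ j → B j) → (i : Fin k) → B i → ∀ j → B j
(c [ i ]≔ b) j with j ≟ i
... | yes refl = b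
... | no _ = c j

[]≔-updates : ∀ {k} {B : Fin k → Set a} (c : ∀ j → B j) i b → (c [ i ]≔ b) i ≡ b
[]≔-updates c i b with i ≟ i
... | yes refl = refl
... | no i≢i = contradiction refl i≢i

[]≔-preserves : ∀ {k} {B : Fin k → Set a} (P : ∀ j → B j → Set ℓ) {c : ∀ j → B j} {i b} →
  (∀ j → P j (c j)) → P i b → ∀ j → P j ((c [ i ]≔ b) j)
[]≔-preserves P {i = i} Pc Pb j with j ≟ i
... | yes refl = Pb
... | no _ = Pc j

∏-cong : ∀ k {m n : Fin k → ℕ} → (∀ i → m i ≡ n i) → ∏ k m ≡ ∏ k n
∏-cong zero m≡n = refl
∏-cong (suc k) m≡n = cong₂ _*_ (m≡n zero) (∏-cong k (m≡n ∘ suc))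

∏-distrib-* : ∀ k (m n : Fin k → ℕ) → ∏ k (λ i → m i * n i) ≡ ∏ k m * ∏ k n
∏-distrib-* zero m n = refl
∏-distrib-* (suc k) m n = begin
  m zero * n zero * ∏ k (λ i → m (suc i) * n (suc i))
    ≡⟨ cong (m zero * n zero *_) (∏-distrib-* k (m ∘ suc) (n ∘ suc)) ⟩
  m zero * n zero * (∏ k (m ∘ suc) * ∏ k (n ∘ suc))
    ≡⟨ interchange (m zero) (n zero) (∏ k (m ∘ suc)) (∏ k (n ∘ suc)) ⟩
  m zero * ∏ k (m ∘ suc) * (n zero * ∏ k (n ∘ suc)) ∎
  where open ≡-Reasoning

blockwise : ∀ {k d} → ((i : Fin k) → Map (Fin (d i))) → Map (Ω k d)
blockwise c (i , x) = i , c i x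

,-injectiveʳ-Ω : ∀ {k d} {i : Fin k} {x y : Fin (d i)} → _≡_ {A = Ω k d} (i , x) (i , y) → x ≡ y
,-injectiveʳ-Ω refl = refl

UnionRel-block : ∀ {k d X} {i : Fin k} {x y : Fin (d i)} → UnionRel k d X (i , x) (i , y) → _~_ (X i) x y
UnionRel-block (ur x~y) = x~y

HasSize-resp : ∀ {A : Set} {P Q : Map A → Set} {n} → (∀ f → P f ⇔ Q f) → HasSize P n → HasSize Q n
HasSize-resp P⇔Q (L , len , unique , membership) =
  L , len , unique , λ f → ⇔.trans (⇔.sym (P⇔Q f)) (membership f)

module _ {k : ℕ} {d : Fin k → ℕ} where

  Family : Set₁
  Family = (i : Fin k) → Map (Fin (d i)) → Set

  component : ∀ {P : Family} {f} → ProdGroup k d P f → (i : Fin k) → Map (Fin (d i))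
  component Pf i = proj₁ (Pf i)

  component-∈ : ∀ {P : Family} {f} (Pf : ProdGroup k d P f) i → P i (component Pf i)
  component-∈ Pf i = proj₁ (proj₂ (Pf i))

  ProdGroup-≈-blockwise : ∀ {P : Family} {f} (Pf : ProdGroup k d P f) → f ≈ blockwise (component Pf)
  ProdGroup-≈-blockwise Pf (i , x) = proj₂ (proj₂ (Pf i)) x

  ProdGroup-blockwise : ∀ {P : Family} {c} → (∀ i → P i (c i)) → ProdGroup k d P (blockwise c)
  ProdGroup-blockwise Pc i = _ , Pc i , λ x → refl

  ProdGroup-resp : ∀ {P : Family} {f g} → f ≈ g → ProdGroup k d P f → ProdGroup k d P g
  ProdGroup-resp f≈g Pf i =
    component Pf i , component-∈ Pf i , λ x → trans (sym (f≈g (i , x))) (ProdGroup-≈-blockwise Pf (i , x))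

  ProdGroup-mono : ∀ {P Q : Family} → (∀ i {f} → P i f → Q i f) →
    ∀ {f} → ProdGroup k d P f → ProdGroup k d Q f
  ProdGroup-mono P⊆Q Pf i = component Pf i , P⊆Q i (component-∈ Pf i) , proj₂ (proj₂ (Pf i))

  ProdGroup-isPermGroup : ∀ {P : Family} → (∀ i → IsPermGroup (P i)) → IsPermGroup (ProdGroup k d P)
  ProdGroup-isPermGroup {P} G = record
    { resp = ProdGroup-resp
    ; hasId = ProdGroup-blockwise (λ i → hasId (G i))
    ; comp = composition
    ; inv = inverse
    }
    where
    open IsPermGroup
    composition : ∀ {f g} → ProdGroup k d P f → ProdGroup k d P g → ProdGroup k d P (f ∘ g)
    composition {f} Pf Pg i =
      component Pf i ∘ component Pg i , comp (G i) (component-∈ Pf i) (component-∈ Pg i) ,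
      λ x → trans (cong f (ProdGroup-≈-blockwise Pg (i , x))) (ProdGroup-≈-blockwise Pf (i , _))
    inverse : ∀ {f} → ProdGroup k d P f →
      Σ[ g ∈ Map (Ω k d) ] (ProdGroup k d P g × (g ∘ f) ≈ id × (f ∘ g) ≈ id)
    inverse {f} Pf = blockwise g , ProdGroup-blockwise (λ i → proj₁ (proj₂ (inverseAt i))) , left , right
      where
      inverseAt : ∀ i →
        Σ[ g ∈ Map (Fin (d i)) ] (P i g × (g ∘ component Pf i) ≈ id × (component Pf i ∘ g) ≈ id)
      inverseAt i = inv (G i) (component-∈ Pf i)
      g : (i : Fin k) → Map (Fin (d i))
      g i = proj₁ (inverseAt i)
      left : (blockwise g ∘ f) ≈ id
      left (i , x) = trans (cong (blockwise g) (ProdGroup-≈-blockwise Pf (i , x)))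
                           (cong (i ,_) (proj₁ (proj₂ (proj₂ (inverseAt i))) x))
      right : (f ∘ blockwise g) ≈ id
      right (i , x) = trans (ProdGroup-≈-blockwise Pf (i , g i x))
                            (cong (i ,_) (proj₂ (proj₂ (proj₂ (inverseAt i))) x))

  ProdGroup-isSubgroup : ∀ {U W : Family} →
    (∀ i → IsSubgroup (U i) (W i)) → IsSubgroup (ProdGroup k d U) (ProdGroup k d W)
  ProdGroup-isSubgroup U≤W = record
    { isGroup = ProdGroup-isPermGroup (IsSubgroup.isGroup ∘ U≤W)
    ; sub = ProdGroup-mono (IsSubgroup.sub ∘ U≤W)
    }

  ProdGroup-orbits : ∀ {U : Family} {X : (i : Fin k) → Partition (Fin (d i))} →
    (∀ i → U i id) → (∀ i → OrbitsAre (U i) (X i)) → OrbitsAre (ProdGroup k d U) (UnionPart k d X)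
  ProdGroup-orbits {U} {X} U-id orbits p q = mk⇔ reach stay
    where
    identities : (i : Fin k) → Map (Fin (d i))
    identities _ = id
    reach : ∀ {p q} → UnionRel k d X p q → ∃[ u ] (ProdGroup k d U u × u p ≡ q)
    reach (ur {i} {x} {y} x~y) with to (orbits i x y) x~y
    ... | g , Ug , gx≡y =
      blockwise (identities [ i ]≔ g) , ProdGroup-blockwise ([]≔-preserves U U-id Ug) ,
      cong (i ,_) (trans (cong (λ h → h x) ([]≔-updates identities i g)) gx≡y)
    stay : ∀ {p q} → ∃[ u ] (ProdGroup k d U u × u p ≡ q) → UnionRel k d X p q
    stay {i , x} (u , Uu , up≡q) =
      subst (UnionRel k d X (i , x)) (trans (sym (ProdGroup-≈-blockwise Uu (i , x))) up≡q)
        (ur (from (orbits i x _) (component Uu i , component-∈ Uu i , refl)))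

  Stab-ProdGroup : ∀ (W : Family) (X : (i : Fin k) → Partition (Fin (d i))) f →
    ProdGroup k d (λ i → Stab (W i) (X i)) f ⇔ Stab (ProdGroup k d W) (UnionPart k d X) f
  Stab-ProdGroup W X f = mk⇔ fixesBlocks restricts
    where
    fixesBlocks : ProdGroup k d (λ i → Stab (W i) (X i)) f → Stab (ProdGroup k d W) (UnionPart k d X) f
    fixesBlocks Sf = ProdGroup-mono (λ _ → proj₁) Sf , λ where
      (i , x) → subst (λ p → UnionRel k d X p (i , x)) (sym (ProdGroup-≈-blockwise Sf (i , x)))
                  (ur (proj₂ (component-∈ Sf i) x))
    restricts : Stab (ProdGroup k d W) (UnionPart k d X) f → ProdGroup k d (λ i → Stab (W i) (X i)) f
    restricts (Wf , fixes) i = component Wf i , (component-∈ Wf i , fixesᵢ) , ProdGroup-≈-blockwise Wf ∘ (i ,_)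
      where
      fixesᵢ : ∀ x → _~_ (X i) (component Wf i x) x
      fixesᵢ x = UnionRel-block
        (subst (λ p → UnionRel k d X p (i , x)) (ProdGroup-≈-blockwise Wf (i , x)) (fixes (i , x)))

  ProdGroup-size : ∀ {P : Family} {n : Fin k → ℕ} →
    (∀ i → HasSize (P i) (n i)) → HasSize (ProdGroup k d P) (∏ k n)
  ProdGroup-size {P} {n} sizes = map blockwise (tuples L) , length-list , unique , membership
    where
    Maps : Fin k → Setoid 0ℓ 0ℓ
    Maps i = Fin (d i) →-setoid Fin (d i)
    MapsΩ : Setoid 0ℓ 0ℓ
    MapsΩ = Ω k d →-setoid Ω k d
    L : ∀ i → List (Map (Fin (d i)))
    L i = proj₁ (sizes i)
    L-membership : ∀ i g → P i g ⇔ _∈_ (Maps i) g (L i)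
    L-membership i = proj₂ (proj₂ (proj₂ (sizes i)))
    blockwise-cong : ∀ {c c′} → Setoid._≈_ (Π-setoid Maps) c c′ → blockwise c ≈ blockwise c′
    blockwise-cong c≈c′ (i , x) = cong (i ,_) (c≈c′ i x)
    length-list : length (map blockwise (tuples L)) ≡ ∏ k n
    length-list = begin
      length (map blockwise (tuples L)) ≡⟨ length-map blockwise (tuples L) ⟩
      length (tuples L)                 ≡⟨ length-tuples L ⟩
      ∏ k (length ∘ L)                  ≡⟨ ∏-cong k (proj₁ ∘ proj₂ ∘ sizes) ⟩
      ∏ k n                             ∎
      where open ≡-Reasoning
    unique : Unique MapsΩ (map blockwise (tuples L))
    unique = Unique.map⁺ (Π-setoid Maps) MapsΩ (λ e i x → ,-injectiveʳ-Ω (e (i , x)))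
               (tuples-unique Maps (proj₁ ∘ proj₂ ∘ proj₂ ∘ sizes))
    listed : ∀ {f} → ProdGroup k d P f → _∈_ MapsΩ f (map blockwise (tuples L))
    listed Pf = ∈-resp-≈ MapsΩ (λ p → sym (ProdGroup-≈-blockwise Pf p))
      (∈-map⁺ (Π-setoid Maps) MapsΩ blockwise-cong
        (from (∈-tuples Maps) (λ i → to (L-membership i _) (component-∈ Pf i))))
    unlisted : ∀ {f} → _∈_ MapsΩ f (map blockwise (tuples L)) → ProdGroup k d P f
    unlisted f∈ with ∈-map⁻ (Π-setoid Maps) MapsΩ f∈
    ... | c , c∈ , f≈c = ProdGroup-resp (λ p → sym (f≈c p))
      (ProdGroup-blockwise (λ i → from (L-membership i (c i)) (to (∈-tuples Maps) c∈ i)))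
    membership : ∀ f → ProdGroup k d P f ⇔ _∈_ MapsΩ f (map blockwise (tuples L))
    membership f = mk⇔ listed unlisted

  ProdGroup-index : ∀ {W : Family} {X : (i : Fin k) → Partition (Fin (d i))} {m : Fin k → ℕ} →
    (∀ i → HasIndex (W i) (X i) (m i)) → HasIndex (ProdGroup k d W) (UnionPart k d X) (∏ k m)
  ProdGroup-index {W} {X} {m} indices =
    ∏ k orderW , ∏ k orderStab ,
    ProdGroup-size sizeW ,
    HasSize-resp (Stab-ProdGroup W X) (ProdGroup-size sizeStab) ,
    trans (∏-cong k orderW≡m*orderStab) (∏-distrib-* k m orderStab)
    where
    orderW orderStab : Fin k → ℕ
    orderW i = proj₁ (indices i)
    orderStab i = proj₁ (proj₂ (indices i))
    sizeW : ∀ i → HasSize (W i) (orderW i)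
    sizeW i = proj₁ (proj₂ (proj₂ (indices i)))
    sizeStab : ∀ i → HasSize (Stab (W i) (X i)) (orderStab i)
    sizeStab i = proj₁ (proj₂ (proj₂ (proj₂ (indices i))))
    orderW≡m*orderStab : ∀ i → orderW i ≡ m i * orderStab i
    orderW≡m*orderStab i = proj₂ (proj₂ (proj₂ (proj₂ (indices i))))

  ProdGroup-subgroupPartition : ∀ {W : Family} {X : (i : Fin k) → Partition (Fin (d i))} →
    (∀ i → IsSubgroupPartition (W i) (X i)) → IsSubgroupPartition (ProdGroup k d W) (UnionPart k d X)
  ProdGroup-subgroupPartition {W} {X} partitions =
    ProdGroup k d U , ProdGroup-isSubgroup U≤W ,
    ProdGroup-orbits (λ i → IsPermGroup.hasId (IsSubgroup.isGroup (U≤W i))) (λ i → proj₂ (proj₂ (partitions i)))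
    where
    U : Family
    U i = proj₁ (partitions i)
    U≤W : ∀ i → IsSubgroup (U i) (W i)
    U≤W i = proj₁ (proj₂ (partitions i))

  restrict : Partition (Ω k d) → (i : Fin k) → Partition (Fin (d i))
  restrict Y i = record
    { _~_ = λ x y → _~_ Y (i , x) (i , y)
    ; isEquiv = record { refl = refl′ ; sym = sym′ ; trans = trans′ }
    }
    where open IsEquivalence (isEquiv Y) renaming (refl to refl′; sym to sym′; trans to trans′)

  restrict-union : (Y : Partition (Ω k d)) → (∀ {i j x y} → _~_ Y (i , x) (j , y) → i ≡ j) →
    SamePartition Y (UnionPart k d (restrict Y))
  restrict-union Y withinBlocks p q = mk⇔ split merge
    where
    split : ∀ {p q} → _~_ Y p q → UnionRel k d (restrict Y) p q
    split {i , x} {j , y} p~q with withinBlocks p~q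
    ... | refl = ur p~q
    merge : ∀ {p q} → UnionRel k d (restrict Y) p q → _~_ Y p q
    merge (ur x~y) = x~y

  project : (Map (Ω k d) → Set) → Family
  project U i f = ∃[ u ] (U u × (∀ x → u (i , x) ≡ (i , f x)))

  module _ {U : Map (Ω k d) → Set} {W : Family} (U⊆W : ∀ {u} → U u → ProdGroup k d W u) where

    component-project : ∀ {u} (Uu : U u) i → project U i (component (U⊆W Uu) i)
    component-project {u} Uu i = u , Uu , ProdGroup-≈-blockwise (U⊆W Uu) ∘ (i ,_)

    acts⇒≈component : ∀ {u} (Uu : U u) {i f} → (∀ x → u (i , x) ≡ (i , f x)) → f ≈ component (U⊆W Uu) i
    acts⇒≈component Uu {i} acts x = ,-injectiveʳ-Ω (trans (sym (acts x)) (ProdGroup-≈-blockwise (U⊆W Uu) (i , x)))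

    orbits-within-blocks : ∀ Y → OrbitsAre U Y → ∀ {i j x y} → _~_ Y (i , x) (j , y) → i ≡ j
    orbits-within-blocks Y orbits {i} {j} {x} {y} x~y with to (orbits (i , x) (j , y)) x~y
    ... | u , Uu , ux≡y = cong proj₁ (trans (sym (ProdGroup-≈-blockwise (U⊆W Uu) (i , x))) ux≡y)

    project-orbits : ∀ Y → OrbitsAre U Y → ∀ i → OrbitsAre (project U i) (restrict Y i)
    project-orbits Y orbits i x y = mk⇔ reach stay
      where
      reach : _~_ Y (i , x) (i , y) → ∃[ f ] (project U i f × f x ≡ y)
      reach x~y with to (orbits (i , x) (i , y)) x~y
      ... | u , Uu , ux≡y = component (U⊆W Uu) i , component-project Uu i ,
                            ,-injectiveʳ-Ω (trans (sym (ProdGroup-≈-blockwise (U⊆W Uu) (i , x))) ux≡y)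
      stay : ∃[ f ] (project U i f × f x ≡ y) → _~_ Y (i , x) (i , y)
      stay (f , (u , Uu , acts) , fx≡y) = from (orbits (i , x) (i , y)) (u , Uu , trans (acts x) (cong (i ,_) fx≡y))

  project-isSubgroup : ∀ {U : Map (Ω k d) → Set} {W : Family} → (∀ i → IsPermGroup (W i)) →
    IsSubgroup U (ProdGroup k d W) → ∀ i → IsSubgroup (project U i) (W i)
  project-isSubgroup {U} {W} G U≤W i = record
    { isGroup = record
      { resp = resp ; hasId = id , hasId UG , (λ x → refl) ; comp = composition ; inv = inverse }
    ; sub = λ where
        (u , Uu , acts) →
          IsPermGroup.resp (G i) (λ x → sym (acts⇒≈component sub Uu acts x)) (component-∈ (sub Uu) i)
    }
    where
    open IsSubgroup U≤W renaming (isGroup to UG)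
    open IsPermGroup hiding (resp)
    resp : ∀ {f g} → f ≈ g → project U i f → project U i g
    resp f≈g (u , Uu , acts) = u , Uu , λ x → trans (acts x) (cong (i ,_) (f≈g x))
    composition : ∀ {f g} → project U i f → project U i g → project U i (f ∘ g)
    composition {g = g} (u , Uu , u-acts) (v , Uv , v-acts) =
      u ∘ v , comp UG Uu Uv , λ x → trans (cong u (v-acts x)) (u-acts (g x))
    inverse : ∀ {f} → project U i f →
      Σ[ g ∈ Map (Fin (d i)) ] (project U i g × (g ∘ f) ≈ id × (f ∘ g) ≈ id)
    inverse {f} (u , Uu , acts) with inv UG Uu
    ... | v , Uv , vu≈id , uv≈id = g , component-project sub Uv i , left , right
      where
      g : Map (Fin (d i))
      g = component (sub Uv) i
      left : (g ∘ f) ≈ id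
      left x = ,-injectiveʳ-Ω (begin
        i , g (f x)      ≡⟨ sym (ProdGroup-≈-blockwise (sub Uv) (i , f x)) ⟩
        v (i , f x)      ≡⟨ cong v (sym (acts x)) ⟩
        v (u (i , x))    ≡⟨ vu≈id (i , x) ⟩
        i , x            ∎)
        where open ≡-Reasoning
      right : (f ∘ g) ≈ id
      right x = ,-injectiveʳ-Ω (begin
        i , f (g x)      ≡⟨ sym (acts (g x)) ⟩
        u (i , g x)      ≡⟨ cong u (sym (ProdGroup-≈-blockwise (sub Uv) (i , x))) ⟩
        u (v (i , x))    ≡⟨ uv≈id (i , x) ⟩
        i , x            ∎)
        where open ≡-Reasoning

mainTheorem4 : (k : ℕ) (d : Fin k → ℕ) (W : (i : Fin k) → Map (Fin (d i)) → Set)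
    → (∀ i → IsPermGroup (W i))
    → (((X : (i : Fin k) → Partition (Fin (d i))) (m : Fin k → ℕ)
        → (∀ i → IsSubgroupPartition (W i) (X i))
        → (∀ i → HasIndex (W i) (X i) (m i))
        → IsSubgroupPartition (ProdGroup k d W) (UnionPart k d X)
          × HasIndex (ProdGroup k d W) (UnionPart k d X) (∏ k m))
      × ((Y : Partition (Ω k d))
        → IsSubgroupPartition (ProdGroup k d W) Y
        → Σ[ X ∈ ((i : Fin k) → Partition (Fin (d i))) ]
            ((∀ i → IsSubgroupPartition (W i) (X i)) × SamePartition Y (UnionPart k d X))))
mainTheorem4 k d W G =
  (λ X m partitions indices → ProdGroup-subgroupPartition partitions , ProdGroup-index indices) ,
  λ where
    Y (U , U≤W , orbits) →
      restrict Y ,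
      (λ i → project U i , project-isSubgroup G U≤W i , project-orbits (IsSubgroup.sub U≤W) Y orbits i) ,
      restrict-union Y (orbits-within-blocks (IsSubgroup.sub U≤W) Y orbits)
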